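{- Let $G$ be a finite group, $H$ a core-free subgroup and $g\in G$ with $g\notin N_G(H)$ and $g^2\in H$, and let $\Gamma=\mathrm{Cos}(G,H,HgH)$. Then for any subgroup $L$ of $G$ with $H\cap H^g<L<H$, the graph $\mathrm{Cos}(G,L,LgL)$ is a spread of $\Gamma$.
   Context: The coset graph $\mathrm{Cos}(G,H,HgH)$ has vertex set the right cosets of $H$ in $G$, with $Hx,Hy$ adjacent iff $xy^{ -1}\in HgH$; $G$ acts by right multiplication. For a $G$-arc-transitive graph $\Sigma$ and a $G$-invariant partition $\mathcal{B}$ of its vertex set, the quotient graph $\Sigma_{\mathcal{B}}$ has vertex set $\mathcal{B}$ with $B,C$ adjacent iff some edge of $\Sigma$ joins a vertex of $B$ to a vertex of $C$. $\Sigma$ is a spread of a graph $\Gamma$ if there is a $G$-invariant partition $\mathcal{B}$ with $\Sigma_{\mathcal{B}}\cong\Gamma$ such that for each arc $(B,C)$ of $\Sigma_{\mathcal{B}}$ there is exactly one arc $(v,w)$ of $\Sigma$ with $v\in B$, $w\in C$. -}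

module Defs where

open import Level using (Level; _⊔_; suc)
open import Algebra.Bundles using (Group)
open import Data.Product using (Σ; ∃; ∃₂; _×_; _,_)
open import Data.List using (List)
open import Data.List.Relation.Unary.Any using (Any)
open import Relation.Nullary using (¬_)
open import Relation.Unary using (Pred)
open import Relation.Binary using (Rel; IsEquivalence)

module GroupTheory {c ℓ : Level} (G : Group c ℓ) where
  open Group G

  Finite : Set (c ⊔ ℓ)
  Finite = Σ (List Carrier) λ xs → ∀ x → Any (x ≈_) xs

  Subset : Set (c ⊔ suc ℓ)
  Subset = Pred Carrier ℓ

  record IsSubgroup (H : Subset) : Set (c ⊔ ℓ) where
    field
      resp : ∀ {x y} → x ≈ y → H x → H y
      ε∈   : H ε
      ∙∈   : ∀ {x y} → H x → H y → H (x ∙ y)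
      ⁻¹∈  : ∀ {x} → H x → H (x ⁻¹)

  _⊆_ : Subset → Subset → Set (c ⊔ ℓ)
  H ⊆ K = ∀ {x} → H x → K x

  _⊂_ : Subset → Subset → Set (c ⊔ ℓ)
  H ⊂ K = H ⊆ K × ∃ λ x → K x × ¬ H x

  _∩_ : Subset → Subset → Subset
  (H ∩ K) x = H x × K x

  -- conjugate H^g = g⁻¹ H g  (x ∈ H^g iff g x g⁻¹ ∈ H)
  _^_ : Subset → Carrier → Subset
  (H ^ g) x = H ((g ∙ x) ∙ g ⁻¹)

  InNormaliser : Subset → Carrier → Set (c ⊔ ℓ)
  InNormaliser H g = (H ^ g) ⊆ H × H ⊆ (H ^ g)

  CoreFree : Subset → Set (c ⊔ ℓ)
  CoreFree H = ∀ x → (∀ y → (H ^ y) x) → x ≈ ε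

  InDoubleCoset : Subset → Carrier → Carrier → Set (c ⊔ ℓ)
  InDoubleCoset H g x = ∃₂ λ h k → H h × H k × x ≈ (h ∙ g) ∙ k

  -- Coset graph Cos(G,H,HgH).  A vertex (right coset Hx) is represented
  -- by any representative x ∈ G; Hx = Hy iff x y⁻¹ ∈ H.
  CosVEq : Subset → Rel Carrier ℓ
  CosVEq H x y = H (x ∙ y ⁻¹)

  CosAdj : Subset → Carrier → Rel Carrier (c ⊔ ℓ)
  CosAdj H g x y = InDoubleCoset H g (x ∙ y ⁻¹)

  -- A G-invariant partition of the vertex set of Cos(G,L,LgL), given
  -- as an equivalence relation P on representatives which is coarser
  -- than coset equality (so it is a relation on cosets) and invariant
  -- under right multiplication.
  record IsInvariantPartition (L : Subset) (P : Rel Carrier ℓ) : Set (c ⊔ ℓ) where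
    field
      equiv  : IsEquivalence P
      onCos  : ∀ {x y} → CosVEq L x y → P x y
      invar  : ∀ {x y} a → P x y → P (x ∙ a) (y ∙ a)

  -- quotient graph: blocks B, C (represented by elements, compared by P)
  -- are adjacent iff some edge joins a vertex of B to a vertex of C
  QuotAdj : Rel Carrier ℓ → Rel Carrier (c ⊔ ℓ) → Rel Carrier (c ⊔ ℓ)
  QuotAdj P Adj B C = ∃₂ λ v w → P v B × P w C × Adj v w

  record GraphIso (VEq₁ : Rel Carrier ℓ) (Adj₁ : Rel Carrier (c ⊔ ℓ))
                  (VEq₂ : Rel Carrier ℓ) (Adj₂ : Rel Carrier (c ⊔ ℓ)) : Set (c ⊔ ℓ) where
    field
      f     : Carrier → Carrier
      cong  : ∀ {x y} → VEq₁ x y → VEq₂ (f x) (f y)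
      inj   : ∀ {x y} → VEq₂ (f x) (f y) → VEq₁ x y
      surj  : ∀ y → ∃ λ x → VEq₂ (f x) y
      adj→  : ∀ {x y} → Adj₁ x y → Adj₂ (f x) (f y)
      adj←  : ∀ {x y} → Adj₂ (f x) (f y) → Adj₁ x y

  IsSpreadOf : (L : Subset) → Carrier → (H : Subset) → Set (c ⊔ suc ℓ)
  IsSpreadOf L g H =
    Σ (Rel Carrier ℓ) λ P →
      IsInvariantPartition L P ×
      GraphIso P (QuotAdj P (CosAdj L g)) (CosVEq H) (CosAdj H g) ×
      (∀ B C → QuotAdj P (CosAdj L g) B C →
        ∃₂ λ v w → P v B × P w C × CosAdj L g v w ×
          (∀ v′ w′ → P v′ B → P w′ C → CosAdj L g v′ w′ →
             CosVEq L v′ v × CosVEq L w′ w))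

module Submission where

-- We show that Cos(G,L,LgL) is a spread of Γ = Cos(G,H,HgH), the partition
-- being into the H-cosets: each block Hx is the union of the L-cosets it
-- contains.  The argument rests on one normal form: x y⁻¹ ∈ KgK (for any
-- subgroup K) iff the cosets Kx, Ky contain representatives x₀, y₀ with
-- x₀ y₀⁻¹ = g.  From it
--   * the quotient of Cos(G,L,LgL) by the H-cosets is Cos(G,H,HgH), for
--     every L ⊆ H (the identity map on representatives is the isomorphism);
--   * two L-arcs between the same two H-blocks have normal forms differing
--     by h, k ∈ H with h g = g k; since g² ∈ H this forces h, k ∈ H ∩ H^g ⊆ L,
--     so the two arcs coincide.

open import Defs
open import Level using (Level)
open import Algebra.Bundles using (Group)
open import Relation.Nullary using (¬_)
open import Data.Product using (∃₂; _×_; _,_; proj₁)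
open import Relation.Binary using (IsEquivalence)
import Algebra.Properties.Group as GroupProperties
import Relation.Binary.Reasoning.Setoid as SetoidReasoning

module CosetGraphs {c ℓ : Level} (G : Group c ℓ) where
  open Group G
  open GroupTheory G
  open GroupProperties G
    using (⁻¹-anti-homo-∙; ⁻¹-involutive; \\-leftDividesˡ; \\-leftDividesʳ; //-rightDividesʳ)
  open SetoidReasoning setoid

  cancel-inner : ∀ x y z → (x ∙ y ⁻¹) ∙ (y ∙ z) ≈ x ∙ z
  cancel-inner x y z = begin
    (x ∙ y ⁻¹) ∙ (y ∙ z)  ≈⟨ assoc x (y ⁻¹) (y ∙ z) ⟩
    x ∙ (y ⁻¹ ∙ (y ∙ z))  ≈⟨ ∙-congˡ (\\-leftDividesʳ y z) ⟩
    x ∙ z                 ∎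

  inverse-of-quotient : ∀ x y → (x ∙ y ⁻¹) ⁻¹ ≈ y ∙ x ⁻¹
  inverse-of-quotient x y =
    trans (⁻¹-anti-homo-∙ x (y ⁻¹)) (∙-congʳ (⁻¹-involutive y))

  factorisations-conjugate : ∀ {x₀ y₀ x₁ y₁ g} →
    x₀ ∙ y₀ ⁻¹ ≈ g → x₁ ∙ y₁ ⁻¹ ≈ g →
    (x₁ ∙ x₀ ⁻¹) ∙ g ≈ g ∙ (y₁ ∙ y₀ ⁻¹)
  factorisations-conjugate {x₀} {y₀} {x₁} {y₁} {g} e₀ e₁ = begin
    (x₁ ∙ x₀ ⁻¹) ∙ g                ≈⟨ ∙-congˡ e₀ ⟨
    (x₁ ∙ x₀ ⁻¹) ∙ (x₀ ∙ y₀ ⁻¹)     ≈⟨ cancel-inner x₁ x₀ (y₀ ⁻¹) ⟩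
    x₁ ∙ y₀ ⁻¹                      ≈⟨ cancel-inner x₁ y₁ (y₀ ⁻¹) ⟨
    (x₁ ∙ y₁ ⁻¹) ∙ (y₁ ∙ y₀ ⁻¹)     ≈⟨ ∙-congʳ e₁ ⟩
    g ∙ (y₁ ∙ y₀ ⁻¹)                ∎

  module RightCosets (K : Subset) (K-sub : IsSubgroup K) where
    open IsSubgroup K-sub

    coset-isEquivalence : IsEquivalence (CosVEq K)
    coset-isEquivalence = record
      { refl  = λ {x} → resp (sym (inverseʳ x)) ε∈
      ; sym   = λ {x} {y} p → resp (inverse-of-quotient x y) (⁻¹∈ p)
      ; trans = λ {x} {y} {z} p q → resp (cancel-inner x y (z ⁻¹)) (∙∈ p q)
      }

    open IsEquivalence coset-isEquivalence public
      renaming (refl to coset-refl; sym to coset-sym; trans to coset-trans)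

    coset-invariant : ∀ {x y} a → CosVEq K x y → CosVEq K (x ∙ a) (y ∙ a)
    coset-invariant {x} {y} a p = resp (sym quotient-unchanged) p
      where
      quotient-unchanged : (x ∙ a) ∙ (y ∙ a) ⁻¹ ≈ x ∙ y ⁻¹
      quotient-unchanged = begin
        (x ∙ a) ∙ (y ∙ a) ⁻¹     ≈⟨ ∙-congˡ (⁻¹-anti-homo-∙ y a) ⟩
        (x ∙ a) ∙ (a ⁻¹ ∙ y ⁻¹)  ≈⟨ assoc x a (a ⁻¹ ∙ y ⁻¹) ⟩
        x ∙ (a ∙ (a ⁻¹ ∙ y ⁻¹))  ≈⟨ ∙-congˡ (\\-leftDividesˡ a (y ⁻¹)) ⟩
        x ∙ y ⁻¹                 ∎

    adjacent⇒normalForm : ∀ {g x y} → CosAdj K g x y →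
      ∃₂ λ x₀ y₀ → CosVEq K x₀ x × CosVEq K y₀ y × x₀ ∙ y₀ ⁻¹ ≈ g
    adjacent⇒normalForm {g} {x} {y} (a , b , a∈K , b∈K , e) =
      a ⁻¹ ∙ x , b ∙ y ,
      resp (sym (//-rightDividesʳ x (a ⁻¹))) (⁻¹∈ a∈K) ,
      resp (sym (//-rightDividesʳ y b)) b∈K ,
      normal
      where
      normal : (a ⁻¹ ∙ x) ∙ (b ∙ y) ⁻¹ ≈ g
      normal = begin
        (a ⁻¹ ∙ x) ∙ (b ∙ y) ⁻¹          ≈⟨ ∙-congˡ (⁻¹-anti-homo-∙ b y) ⟩
        (a ⁻¹ ∙ x) ∙ (y ⁻¹ ∙ b ⁻¹)       ≈⟨ assoc (a ⁻¹) x (y ⁻¹ ∙ b ⁻¹) ⟩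
        a ⁻¹ ∙ (x ∙ (y ⁻¹ ∙ b ⁻¹))       ≈⟨ ∙-congˡ (assoc x (y ⁻¹) (b ⁻¹)) ⟨
        a ⁻¹ ∙ ((x ∙ y ⁻¹) ∙ b ⁻¹)       ≈⟨ ∙-congˡ (∙-congʳ e) ⟩
        a ⁻¹ ∙ (((a ∙ g) ∙ b) ∙ b ⁻¹)    ≈⟨ ∙-congˡ (//-rightDividesʳ b (a ∙ g)) ⟩
        a ⁻¹ ∙ (a ∙ g)                   ≈⟨ \\-leftDividesʳ a g ⟩
        g                                ∎

    normalForm⇒adjacent : ∀ {g x y x₀ y₀} →
      CosVEq K x x₀ → CosVEq K y y₀ → x₀ ∙ y₀ ⁻¹ ≈ g → CosAdj K g x y
    normalForm⇒adjacent {g} {x} {y} {x₀} {y₀} x∼x₀ y∼y₀ e =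
      x ∙ x₀ ⁻¹ , (y ∙ y₀ ⁻¹) ⁻¹ , x∼x₀ , ⁻¹∈ y∼y₀ , factorised
      where
      factorised : x ∙ y ⁻¹ ≈ ((x ∙ x₀ ⁻¹) ∙ g) ∙ (y ∙ y₀ ⁻¹) ⁻¹
      factorised = begin
        x ∙ y ⁻¹                               ≈⟨ cancel-inner x y₀ (y ⁻¹) ⟨
        (x ∙ y₀ ⁻¹) ∙ (y₀ ∙ y ⁻¹)              ≈⟨ ∙-congʳ (cancel-inner x x₀ (y₀ ⁻¹)) ⟨
        ((x ∙ x₀ ⁻¹) ∙ (x₀ ∙ y₀ ⁻¹)) ∙ (y₀ ∙ y ⁻¹)
          ≈⟨ ∙-cong (∙-congˡ e) (sym (inverse-of-quotient y y₀)) ⟩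
        ((x ∙ x₀ ⁻¹) ∙ g) ∙ (y ∙ y₀ ⁻¹) ⁻¹     ∎

  -- If h g = g k with h, k ∈ H and g² ∈ H, then h, k ∈ H ∩ H^g:
  -- k^{g⁻¹} = h ∈ H directly, and h^{g⁻¹} = g² k g⁻² ∈ H.
  commuting⇒inIntersection : ∀ {H} → IsSubgroup H → ∀ {g h k} → H (g ∙ g) →
    H h → H k → h ∙ g ≈ g ∙ k → (H ∩ (H ^ g)) h × (H ∩ (H ^ g)) k
  commuting⇒inIntersection {H} H-sub {g} {h} {k} g²∈H h∈H k∈H hg≈gk =
    (h∈H , resp conjugate-h (∙∈ (∙∈ g²∈H k∈H) (⁻¹∈ g²∈H))) ,
    (k∈H , resp h≈conjugate-k h∈H)
    where
    open IsSubgroup H-sub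
    h≈conjugate-k : h ≈ (g ∙ k) ∙ g ⁻¹
    h≈conjugate-k = trans (sym (//-rightDividesʳ g h)) (∙-congʳ hg≈gk)
    conjugate-h : ((g ∙ g) ∙ k) ∙ (g ∙ g) ⁻¹ ≈ (g ∙ h) ∙ g ⁻¹
    conjugate-h = begin
      ((g ∙ g) ∙ k) ∙ (g ∙ g) ⁻¹       ≈⟨ ∙-cong (assoc g g k) (⁻¹-anti-homo-∙ g g) ⟩
      (g ∙ (g ∙ k)) ∙ (g ⁻¹ ∙ g ⁻¹)    ≈⟨ assoc (g ∙ (g ∙ k)) (g ⁻¹) (g ⁻¹) ⟨
      ((g ∙ (g ∙ k)) ∙ g ⁻¹) ∙ g ⁻¹    ≈⟨ ∙-congʳ (assoc g (g ∙ k) (g ⁻¹)) ⟩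
      (g ∙ ((g ∙ k) ∙ g ⁻¹)) ∙ g ⁻¹    ≈⟨ ∙-congʳ (∙-congˡ h≈conjugate-k) ⟨
      (g ∙ h) ∙ g ⁻¹                   ∎

  module Refinement {H L : Subset} (H-sub : IsSubgroup H) (L-sub : IsSubgroup L)
                    (L⊆H : L ⊆ H) (g : Carrier) where
    open RightCosets H H-sub
    open RightCosets L L-sub using () renaming
      ( coset-refl to L-refl; coset-sym to L-sym; coset-trans to L-trans
      ; adjacent⇒normalForm to L-normalForm
      ; normalForm⇒adjacent to L-adjacent)

    H-cosets-partition : IsInvariantPartition L (CosVEq H)
    H-cosets-partition = record
      { equiv = coset-isEquivalence ; onCos = L⊆H ; invar = coset-invariant }

    quotient⇒adjacent : ∀ {x y} →
      QuotAdj (CosVEq H) (CosAdj L g) x y → CosAdj H g x y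
    quotient⇒adjacent (v , w , v∼x , w∼y , vw-edge)
      with L-normalForm vw-edge
    ... | v₀ , w₀ , v₀∼v , w₀∼w , e =
      normalForm⇒adjacent
        (coset-trans (coset-sym v∼x) (coset-sym (L⊆H v₀∼v)))
        (coset-trans (coset-sym w∼y) (coset-sym (L⊆H w₀∼w))) e

    adjacent⇒quotient : ∀ {x y} →
      CosAdj H g x y → QuotAdj (CosVEq H) (CosAdj L g) x y
    adjacent⇒quotient xy-edge with adjacent⇒normalForm xy-edge
    ... | x₀ , y₀ , x₀∼x , y₀∼y , e =
      x₀ , y₀ , x₀∼x , y₀∼y , L-adjacent L-refl L-refl e

    quotient-isomorphism :
      GraphIso (CosVEq H) (QuotAdj (CosVEq H) (CosAdj L g)) (CosVEq H) (CosAdj H g)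
    quotient-isomorphism = record
      { f = λ x → x ; cong = λ p → p ; inj = λ p → p
      ; surj = λ y → y , coset-refl
      ; adj→ = quotient⇒adjacent ; adj← = adjacent⇒quotient }

    same-H-block : ∀ {x₁ x′ x x₀} → CosVEq L x₁ x′ → CosVEq H x′ x →
      CosVEq L x₀ x → CosVEq H x₁ x₀
    same-H-block x₁∼x′ x′∼x x₀∼x =
      coset-trans (L⊆H x₁∼x′) (coset-trans x′∼x (coset-sym (L⊆H x₀∼x)))

    edge-unique : (H ∩ (H ^ g)) ⊆ L → H (g ∙ g) → ∀ {v w v′ w′} →
      CosAdj L g v w → CosAdj L g v′ w′ → CosVEq H v′ v → CosVEq H w′ w →
      CosVEq L v′ v × CosVEq L w′ w
    edge-unique H∩H^g⊆L g²∈H vw-edge v′w′-edge v′∼v w′∼w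
      with L-normalForm vw-edge | L-normalForm v′w′-edge
    ... | v₀ , w₀ , v₀∼v , w₀∼w , e | v₁ , w₁ , v₁∼v′ , w₁∼w′ , e′
      with commuting⇒inIntersection H-sub g²∈H
             (same-H-block v₁∼v′ v′∼v v₀∼v) (same-H-block w₁∼w′ w′∼w w₀∼w)
             (factorisations-conjugate e e′)
    ... | h∈H∩H^g , k∈H∩H^g =
      L-trans (L-sym v₁∼v′) (L-trans (H∩H^g⊆L h∈H∩H^g) v₀∼v) ,
      L-trans (L-sym w₁∼w′) (L-trans (H∩H^g⊆L k∈H∩H^g) w₀∼w)

lemma2p6 : ∀ {c ℓ : Level} (G : Group c ℓ) →
    GroupTheory.Finite G →
    (H : GroupTheory.Subset G) → GroupTheory.IsSubgroup G H → GroupTheory.CoreFree G H →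
    (g : Group.Carrier G) → ¬ GroupTheory.InNormaliser G H g → H (Group._∙_ G g g) →
    (L : GroupTheory.Subset G) → GroupTheory.IsSubgroup G L →
    GroupTheory._⊂_ G (GroupTheory._∩_ G H (GroupTheory._^_ G H g)) L →
    GroupTheory._⊂_ G L H →
    GroupTheory.IsSpreadOf G L g H
lemma2p6 G _ H H-sub _ g _ g²∈H L L-sub H∩H^g⊂L L⊂H =
  CosVEq H , H-cosets-partition , quotient-isomorphism , one-arc
  where
  open CosetGraphs G
  open Refinement H-sub L-sub (proj₁ L⊂H) g
  open RightCosets H H-sub using (coset-trans; coset-sym)
  open GroupTheory G using (CosVEq; CosAdj; QuotAdj)
  one-arc : ∀ B C → QuotAdj (CosVEq H) (CosAdj L g) B C →
    ∃₂ λ v w → CosVEq H v B × CosVEq H w C × CosAdj L g v w ×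
      (∀ v′ w′ → CosVEq H v′ B → CosVEq H w′ C → CosAdj L g v′ w′ →
         CosVEq L v′ v × CosVEq L w′ w)
  one-arc B C (v , w , v∼B , w∼C , vw-edge) =
    v , w , v∼B , w∼C , vw-edge ,
    λ v′ w′ v′∼B w′∼C v′w′-edge →
      edge-unique (proj₁ H∩H^g⊂L) g²∈H vw-edge v′w′-edge
        (coset-trans v′∼B (coset-sym v∼B)) (coset-trans w′∼C (coset-sym w∼C))
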